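{- Let $p>2$ be a prime, let $\alpha\in\mathbb{Q}_p$ be a quadratic irrational over $\mathbb{Q}$, and let $n\ge0$ be an integer. If $|\alpha-\alpha^c|_p\ge\frac{1}{p^{2n}}$, then the complete quotient $\alpha_{n+2}$ of the Browkin continued fraction expansion of $\alpha$ is regular.
   Context: Let $\mathcal{Y}=\mathbb{Z}[1/p]\cap(-p/2,p/2)$; for $\gamma\in\mathbb{Q}_p$, $s(\gamma)$ is the unique element of $\mathcal{Y}$ with $|\gamma-s(\gamma)|_p<1$. The Browkin continued fraction of $\alpha$ is obtained by $\alpha_0=\alpha$, $a_n=s(\alpha_n)$, $\alpha_{n+1}=1/(\alpha_n-a_n)$; the $\alpha_n$ are the complete quotients, all lying in $\mathbb{Q}(\alpha)\subset\mathbb{Q}_p$. For $x\in\mathbb{Q}(\alpha)$, $x^c$ denotes its conjugate under the nontrivial automorphism of $\mathbb{Q}(\alpha)$. An element $x\in\mathbb{Q}(\alpha)$ is called regular if $v_p(x)<0$ and $v_p(x^c)>0$. -}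

module Defs where

open import Data.Nat as ℕ using (ℕ; zero; suc; _^_)
open import Data.Integer as ℤ using (ℤ; +_)
open import Data.Integer.Divisibility as ℤD using ()
open import Data.Rational as ℚ using (ℚ; ↥_; ↧_; ↧ₙ_; _/_; 0ℚ; 1ℚ)
open import Data.Product using (Σ; ∃; ∃-syntax; _×_; _,_)
open import Relation.Binary.PropositionalEquality using (_≡_)
open import Relation.Nullary using (¬_)

-- The quadratic field Q(√D), D ∈ ℤ a non-square, realised as pairs (a , b)
-- standing for a + b√D.  The embedding into Q_p is fixed by a p-adic integer
-- ω with ω² = D, given by a compatible sequence of approximations (see
-- IsSqrtSeq below); a + b√D ↦ a + bω.
K : Set
K = ℚ × ℚ

module _ (D : ℤ) where
  _⊕_ : K → K → K
  (a , b) ⊕ (c , d) = (a ℚ.+ c , b ℚ.+ d)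

  _⊖_ : K → K → K
  (a , b) ⊖ (c , d) = (a ℚ.- c , b ℚ.- d)

  _⊗_ : K → K → K
  (a , b) ⊗ (c , d) = (a ℚ.* c ℚ.+ (D / 1) ℚ.* (b ℚ.* d) , a ℚ.* d ℚ.+ b ℚ.* c)

embed : ℚ → K
embed q = (q , 0ℚ)

oneK : K
oneK = (1ℚ , 0ℚ)

conj : K → K
conj (a , b) = (a , ℚ.- b)

pow : ℕ → ℕ → ℤ
pow p k = + (p ^ k)

-- r : ℕ → ℤ represents a p-adic integer ω = lim r k with ω² = D:
-- r (k+1) ≡ r k (mod p^k) and r k² ≡ D (mod p^k).
IsSqrtSeq : (p : ℕ) (D : ℤ) (r : ℕ → ℤ) → Set
IsSqrtSeq p D r =
  (∀ k → pow p k ℤD.∣ (r (suc k) ℤ.- r k)) ×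
  (∀ k → pow p k ℤD.∣ (r k ℤ.* r k ℤ.- D))

-- ValGe p r m x  :⇔  v_p(x) ≥ m  (for m : ℕ), where x = a + bω ∈ Q_p.
-- Writing x = (A + Bω)/C with A,B,C ∈ ℤ, C ≠ 0, this says
-- (A + Bω)/(C p^m) ∈ Z_p, which holds iff for every k there is an
-- integer z with A + Bω ≡ C p^m z (mod p^k), i.e. p^k ∣ A + B r_k - C p^m z.
ValGe : (p : ℕ) (r : ℕ → ℤ) (m : ℕ) → K → Set
ValGe p r m (a , b) =
  ∀ k → ∃[ z ] (pow p k ℤD.∣ ((A ℤ.+ B ℤ.* r k) ℤ.- (C ℤ.* pow p m) ℤ.* z))
  where
    A = ↥ a ℤ.* ↧ b
    B = ↥ b ℤ.* ↧ a
    C = ↧ a ℤ.* ↧ b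

InY : (p : ℕ) → ℚ → Set
InY p q = (∃[ e ] (↧ₙ q ≡ p ^ e)) × ((ℚ.- ((+ p) / 2) ℚ.< q) × (q ℚ.< (+ p) / 2))

-- (aₙ, αₙ) is the Browkin continued fraction expansion of x:
-- α₀ = x, aₙ ∈ 𝒴 with |αₙ - aₙ|_p < 1 (i.e. aₙ = s(αₙ)), αₙ₊₁ (αₙ - aₙ) = 1.
IsBrowkinCF : (p : ℕ) (D : ℤ) (r : ℕ → ℤ) (x : K) (a : ℕ → ℚ) (α : ℕ → K) → Set
IsBrowkinCF p D r x a α =
  (α 0 ≡ x) ×
  (∀ n → InY p (a n) ×
         ValGe p r 1 (_⊖_ D (α n) (embed (a n))) ×
         (_⊗_ D (α (suc n)) (_⊖_ D (α n) (embed (a n))) ≡ oneK))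

Regular : (p : ℕ) (r : ℕ → ℤ) → K → Set
Regular p r x = (¬ ValGe p r 0 x) × ValGe p r 1 (conj x)

-- Put ε_j = α_j − a_j. Then v(ε_j) ≥ 1, α_{j+1} ε_j = 1 and, conjugating, α_{j+1}ᶜ ε_jᶜ = 1;
-- hence v(α_{j+1}) < 0 for every j. If v(ε_jᶜ) ≤ 0 for some j ≤ n, then v(α_{j+1}ᶜ) ≥ 0, and
-- this improves and propagates: once v(α_kᶜ) ≥ 0, ε_kᶜ cannot be integral (else so would be
-- α_k = ε_k − ε_kᶜ + α_kᶜ), so v(α_{k+1}ᶜ) = −v(ε_kᶜ) ≥ 1. Hence α_{n+2} is regular. Otherwise
-- v(ε_jᶜ) ≥ 1 for all j ≤ n, and iterating α_j − α_jᶜ = (α_{j+1}ᶜ − α_{j+1}) ε_j ε_jᶜ gives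
-- v(α − αᶜ) ≥ 2n + 1, which the hypothesis excludes.
--
-- Valuations are computed on integer representatives x = (A + Bω)/C: v(x) ≥ m iff p^(t+m)
-- divides A + B r_(t+m), where p^t is the exact power of p dividing C.

module Submission where

open import Defs
open import Data.Nat using (ℕ; suc; _<_; _*_)
open import Data.Nat.Primality using (Prime)
open import Data.Integer using (ℤ)
open import Data.Rational using (ℚ; _/_; 0ℚ)
open import Data.Product using (_×_; _,_)
open import Relation.Binary.PropositionalEquality using (_≡_; _≢_)
open import Relation.Nullary using (¬_)

import Data.Nat as ℕ
import Data.Nat.Properties as ℕP
import Data.Nat.Divisibility as ℕ∣
import Data.Nat.Tactic.RingSolver as ℕSolver
open import Data.Nat.Coprimality using (Coprime; coprime-divisor; coprime-Bézout)
open import Data.Nat.GCD using (module Bézout)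
open import Data.Nat.Induction using (<-wellFounded)
open import Data.Nat.Primality using (prime⇒irreducible; prime⇒nonZero; prime⇒nonTrivial)
import Data.Integer as ℤ
import Data.Integer.Properties as ℤP
import Data.Integer.Divisibility.Signed as ℤ∣
open import Data.Integer.Divisibility.Signed using (divides; quotient)
open import Data.Integer.Tactic.RingSolver using (solve-∀)
import Data.Rational as ℚ
open import Data.Rational using (↥_; ↧_)
import Data.Rational.Properties as ℚP
import Data.Rational.Unnormalised as ℚᵘ
import Data.Rational.Unnormalised.Properties as ℚᵘP
import Tactic.RingSolver as RingSolver
import Tactic.RingSolver.Core.AlmostCommutativeRing as ACR
open import Data.Empty using (⊥-elim)
open import Data.Product using (∃; ∃₂; proj₁; proj₂; map₂)
open import Data.Sum using (_⊎_; inj₁; inj₂; [_,_]′)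
open import Function using (_∘_; id)
open import Induction.WellFounded using (Acc; acc)
open import Level using (0ℓ)
open import Relation.Binary.PropositionalEquality
  using (refl; sym; trans; cong; cong₂; subst; subst₂; module ≡-Reasoning)
open import Relation.Nullary using (Dec; yes; no)
open import Relation.Nullary.Decidable using (dec⇒maybe)
open import Relation.Unary using (Decidable)

-- The zero test lets the reflective solver simplify constant subterms such as 0ℚ * b.
ℚ-ring : ACR.AlmostCommutativeRing 0ℓ 0ℓ
ℚ-ring = ACR.fromCommutativeRing ℚP.+-*-commutativeRing (λ q → dec⇒maybe (0ℚ ℚP.≟ q))

fromℤ : ℤ → ℚ
fromℤ i = i / 1

toℚᵘ-fromℤ : ∀ i → ℚ.toℚᵘ (fromℤ i) ℚᵘ.≃ ℚᵘ.mkℚᵘ i 0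
toℚᵘ-fromℤ i = ℚP.toℚᵘ-fromℚᵘ (ℚᵘ.mkℚᵘ i 0)

fromℤ-* : ∀ i j → fromℤ (i ℤ.* j) ≡ fromℤ i ℚ.* fromℤ j
fromℤ-* i j = ℚP.toℚᵘ-injective (begin
  ℚ.toℚᵘ (fromℤ (i ℤ.* j))               ≈⟨ toℚᵘ-fromℤ (i ℤ.* j) ⟩
  ℚᵘ.mkℚᵘ i 0 ℚᵘ.* ℚᵘ.mkℚᵘ j 0           ≈⟨ ℚᵘP.*-cong (toℚᵘ-fromℤ i) (toℚᵘ-fromℤ j) ⟨
  ℚ.toℚᵘ (fromℤ i) ℚᵘ.* ℚ.toℚᵘ (fromℤ j) ≈⟨ ℚP.toℚᵘ-homo-* (fromℤ i) (fromℤ j) ⟨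
  ℚ.toℚᵘ (fromℤ i ℚ.* fromℤ j)           ∎)
  where open ℚᵘP.≃-Reasoning

fromℤ-+ : ∀ i j → fromℤ (i ℤ.+ j) ≡ fromℤ i ℚ.+ fromℤ j
fromℤ-+ i j = ℚP.toℚᵘ-injective (begin
  ℚ.toℚᵘ (fromℤ (i ℤ.+ j))               ≈⟨ toℚᵘ-fromℤ (i ℤ.+ j) ⟩
  ℚᵘ.mkℚᵘ (i ℤ.+ j) 0                    ≈⟨ ℚᵘ.*≡* (over-one i j) ⟩
  ℚᵘ.mkℚᵘ i 0 ℚᵘ.+ ℚᵘ.mkℚᵘ j 0           ≈⟨ ℚᵘP.+-cong (toℚᵘ-fromℤ i) (toℚᵘ-fromℤ j) ⟨
  ℚ.toℚᵘ (fromℤ i) ℚᵘ.+ ℚ.toℚᵘ (fromℤ j) ≈⟨ ℚP.toℚᵘ-homo-+ (fromℤ i) (fromℤ j) ⟨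
  ℚ.toℚᵘ (fromℤ i ℚ.+ fromℤ j)           ∎)
  where
  open ℚᵘP.≃-Reasoning
  over-one : ∀ i j → (i ℤ.+ j) ℤ.* ℤ.1ℤ ≡ (i ℤ.* ℤ.1ℤ ℤ.+ j ℤ.* ℤ.1ℤ) ℤ.* ℤ.1ℤ
  over-one = solve-∀

fromℤ-neg : ∀ i → fromℤ (ℤ.- i) ≡ ℚ.- fromℤ i
fromℤ-neg i = ℚP.toℚᵘ-injective (begin
  ℚ.toℚᵘ (fromℤ (ℤ.- i))  ≈⟨ toℚᵘ-fromℤ (ℤ.- i) ⟩
  ℚᵘ.- ℚᵘ.mkℚᵘ i 0        ≈⟨ ℚᵘP.-‿cong (toℚᵘ-fromℤ i) ⟨
  ℚᵘ.- ℚ.toℚᵘ (fromℤ i)   ≈⟨ ℚP.toℚᵘ-homo‿- (fromℤ i) ⟨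
  ℚ.toℚᵘ (ℚ.- fromℤ i)    ∎)
  where open ℚᵘP.≃-Reasoning

fromℤ-minus : ∀ i j → fromℤ (i ℤ.- j) ≡ fromℤ i ℚ.- fromℤ j
fromℤ-minus i j = trans (fromℤ-+ i (ℤ.- j)) (cong (fromℤ i ℚ.+_) (fromℤ-neg j))

fromℤ-injective : ∀ {i j} → fromℤ i ≡ fromℤ j → i ≡ j
fromℤ-injective {i} {j} eq with ℚᵘP.≃-trans (ℚᵘP.≃-sym (toℚᵘ-fromℤ i))
                                  (ℚᵘP.≃-trans (ℚP.toℚᵘ-cong eq) (toℚᵘ-fromℤ j))
... | ℚᵘ.*≡* i*1≡j*1 = trans (sym (ℤP.*-identityʳ i)) (trans i*1≡j*1 (ℤP.*-identityʳ j))

*-fromℤ-↧ : ∀ q → q ℚ.* fromℤ (↧ q) ≡ fromℤ (↥ q)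
*-fromℤ-↧ q@(ℚ.mkℚ n d-1 _) = ℚP.toℚᵘ-injective (begin
  ℚ.toℚᵘ (q ℚ.* fromℤ (↧ q))          ≈⟨ ℚP.toℚᵘ-homo-* q (fromℤ (↧ q)) ⟩
  ℚ.toℚᵘ q ℚᵘ.* ℚ.toℚᵘ (fromℤ (↧ q))  ≈⟨ ℚᵘP.*-congˡ {ℚ.toℚᵘ q} (toℚᵘ-fromℤ (↧ q)) ⟩
  ℚ.toℚᵘ q ℚᵘ.* ℚᵘ.mkℚᵘ (↧ q) 0       ≈⟨ ℚᵘ.*≡* denominator-cancels ⟩
  ℚᵘ.mkℚᵘ n 0                         ≈⟨ toℚᵘ-fromℤ n ⟨
  ℚ.toℚᵘ (fromℤ (↥ q))                ∎)
  where
  open ℚᵘP.≃-Reasoning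
  denominator-cancels : (n ℤ.* ↧ q) ℤ.* ℤ.1ℤ ≡ n ℤ.* ℤ.+ (suc d-1 * 1)
  denominator-cancels = trans (ℤP.*-identityʳ (n ℤ.* ↧ q))
                              (cong (λ m → n ℤ.* ℤ.+ m) (sym (ℕP.*-identityʳ (suc d-1))))

*-fromℤ-↧* : ∀ q i → q ℚ.* fromℤ (↧ q ℤ.* i) ≡ fromℤ (↥ q ℤ.* i)
*-fromℤ-↧* q i = begin
  q ℚ.* fromℤ (↧ q ℤ.* i)          ≡⟨ cong (q ℚ.*_) (fromℤ-* (↧ q) i) ⟩
  q ℚ.* (fromℤ (↧ q) ℚ.* fromℤ i)  ≡⟨ ℚP.*-assoc q _ _ ⟨
  q ℚ.* fromℤ (↧ q) ℚ.* fromℤ i    ≡⟨ cong (ℚ._* fromℤ i) (*-fromℤ-↧ q) ⟩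
  fromℤ (↥ q) ℚ.* fromℤ i          ≡⟨ fromℤ-* (↥ q) i ⟨
  fromℤ (↥ q ℤ.* i)                ∎
  where open ≡-Reasoning

record Represents (x : K) (A B C : ℤ) : Set where
  constructor represents
  field
    real      : proj₁ x ℚ.* fromℤ C ≡ fromℤ A
    imaginary : proj₂ x ℚ.* fromℤ C ≡ fromℤ B

canonA canonB canonC : K → ℤ
canonA (a , b) = ↥ a ℤ.* ↧ b
canonB (a , b) = ↥ b ℤ.* ↧ a
canonC (a , b) = ↧ a ℤ.* ↧ b

canonC≢0 : ∀ x → canonC x ≢ ℤ.0ℤ
canonC≢0 (ℚ.mkℚ _ _ _ , ℚ.mkℚ _ _ _) ()

canonC*canonC≢0 : ∀ x y → canonC x ℤ.* canonC y ≢ ℤ.0ℤ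
canonC*canonC≢0 (ℚ.mkℚ _ _ _ , ℚ.mkℚ _ _ _) (ℚ.mkℚ _ _ _ , ℚ.mkℚ _ _ _) ()

canon-represents : ∀ x → Represents x (canonA x) (canonB x) (canonC x)
canon-represents (a , b) = represents
  (*-fromℤ-↧* a (↧ b))
  (subst (λ c → b ℚ.* fromℤ c ≡ fromℤ (↥ b ℤ.* ↧ a)) (ℤP.*-comm (↧ b) (↧ a)) (*-fromℤ-↧* b (↧ a)))

represents-⊗ : ∀ D {x y A B C A′ B′ C′} → Represents x A B C → Represents y A′ B′ C′ →
  Represents (_⊗_ D x y) (A ℤ.* A′ ℤ.+ D ℤ.* (B ℤ.* B′)) (A ℤ.* B′ ℤ.+ B ℤ.* A′) (C ℤ.* C′)
represents-⊗ D {a , b} {c , d} {A} {B} {C} {A′} {B′} {C′} (represents aC bC) (represents cC′ dC′) =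
  represents real imaginary
  where
  open ≡-Reasoning
  δ = fromℤ D
  real-rearranged : ∀ a b c d δ C C′ →
    (a ℚ.* c ℚ.+ δ ℚ.* (b ℚ.* d)) ℚ.* (C ℚ.* C′)
    ≡ (a ℚ.* C) ℚ.* (c ℚ.* C′) ℚ.+ δ ℚ.* ((b ℚ.* C) ℚ.* (d ℚ.* C′))
  real-rearranged = RingSolver.solve-∀ ℚ-ring
  imaginary-rearranged : ∀ a b c d C C′ →
    (a ℚ.* d ℚ.+ b ℚ.* c) ℚ.* (C ℚ.* C′) ≡ (a ℚ.* C) ℚ.* (d ℚ.* C′) ℚ.+ (b ℚ.* C) ℚ.* (c ℚ.* C′)
  imaginary-rearranged = RingSolver.solve-∀ ℚ-ring
  real : (a ℚ.* c ℚ.+ δ ℚ.* (b ℚ.* d)) ℚ.* fromℤ (C ℤ.* C′) ≡ fromℤ (A ℤ.* A′ ℤ.+ D ℤ.* (B ℤ.* B′))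
  real = begin
    (a ℚ.* c ℚ.+ δ ℚ.* (b ℚ.* d)) ℚ.* fromℤ (C ℤ.* C′)
      ≡⟨ cong ((a ℚ.* c ℚ.+ δ ℚ.* (b ℚ.* d)) ℚ.*_) (fromℤ-* C C′) ⟩
    (a ℚ.* c ℚ.+ δ ℚ.* (b ℚ.* d)) ℚ.* (fromℤ C ℚ.* fromℤ C′)
      ≡⟨ real-rearranged a b c d δ (fromℤ C) (fromℤ C′) ⟩
    (a ℚ.* fromℤ C) ℚ.* (c ℚ.* fromℤ C′) ℚ.+ δ ℚ.* ((b ℚ.* fromℤ C) ℚ.* (d ℚ.* fromℤ C′))
      ≡⟨ cong₂ (λ u v → u ℚ.+ δ ℚ.* v) (cong₂ ℚ._*_ aC cC′) (cong₂ ℚ._*_ bC dC′) ⟩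
    fromℤ A ℚ.* fromℤ A′ ℚ.+ δ ℚ.* (fromℤ B ℚ.* fromℤ B′)
      ≡⟨ cong₂ (λ u v → u ℚ.+ δ ℚ.* v) (fromℤ-* A A′) (fromℤ-* B B′) ⟨
    fromℤ (A ℤ.* A′) ℚ.+ δ ℚ.* fromℤ (B ℤ.* B′)
      ≡⟨ cong (fromℤ (A ℤ.* A′) ℚ.+_) (fromℤ-* D (B ℤ.* B′)) ⟨
    fromℤ (A ℤ.* A′) ℚ.+ fromℤ (D ℤ.* (B ℤ.* B′))
      ≡⟨ fromℤ-+ (A ℤ.* A′) (D ℤ.* (B ℤ.* B′)) ⟨
    fromℤ (A ℤ.* A′ ℤ.+ D ℤ.* (B ℤ.* B′))
      ∎
  imaginary : (a ℚ.* d ℚ.+ b ℚ.* c) ℚ.* fromℤ (C ℤ.* C′) ≡ fromℤ (A ℤ.* B′ ℤ.+ B ℤ.* A′)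
  imaginary = begin
    (a ℚ.* d ℚ.+ b ℚ.* c) ℚ.* fromℤ (C ℤ.* C′)
      ≡⟨ cong ((a ℚ.* d ℚ.+ b ℚ.* c) ℚ.*_) (fromℤ-* C C′) ⟩
    (a ℚ.* d ℚ.+ b ℚ.* c) ℚ.* (fromℤ C ℚ.* fromℤ C′)
      ≡⟨ imaginary-rearranged a b c d (fromℤ C) (fromℤ C′) ⟩
    (a ℚ.* fromℤ C) ℚ.* (d ℚ.* fromℤ C′) ℚ.+ (b ℚ.* fromℤ C) ℚ.* (c ℚ.* fromℤ C′)
      ≡⟨ cong₂ ℚ._+_ (cong₂ ℚ._*_ aC dC′) (cong₂ ℚ._*_ bC cC′) ⟩
    fromℤ A ℚ.* fromℤ B′ ℚ.+ fromℤ B ℚ.* fromℤ A′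
      ≡⟨ cong₂ ℚ._+_ (fromℤ-* A B′) (fromℤ-* B A′) ⟨
    fromℤ (A ℤ.* B′) ℚ.+ fromℤ (B ℤ.* A′)
      ≡⟨ fromℤ-+ (A ℤ.* B′) (B ℤ.* A′) ⟨
    fromℤ (A ℤ.* B′ ℤ.+ B ℤ.* A′)
      ∎

represents-⊖ : ∀ D {x y A B C A′ B′ C′} → Represents x A B C → Represents y A′ B′ C′ →
  Represents (_⊖_ D x y) (A ℤ.* C′ ℤ.- A′ ℤ.* C) (B ℤ.* C′ ℤ.- B′ ℤ.* C) (C ℤ.* C′)
represents-⊖ D {a , b} {c , d} {A} {B} {C} {A′} {B′} {C′} (represents aC bC) (represents cC′ dC′) =
  represents (difference a c A A′ aC cC′) (difference b d B B′ bC dC′)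
  where
  open ≡-Reasoning
  rearranged : ∀ a c C C′ → (a ℚ.- c) ℚ.* (C ℚ.* C′) ≡ (a ℚ.* C) ℚ.* C′ ℚ.- (c ℚ.* C′) ℚ.* C
  rearranged = RingSolver.solve-∀ ℚ-ring
  difference : ∀ a c A A′ → a ℚ.* fromℤ C ≡ fromℤ A → c ℚ.* fromℤ C′ ≡ fromℤ A′ →
               (a ℚ.- c) ℚ.* fromℤ (C ℤ.* C′) ≡ fromℤ (A ℤ.* C′ ℤ.- A′ ℤ.* C)
  difference a c A A′ aC cC′ = begin
    (a ℚ.- c) ℚ.* fromℤ (C ℤ.* C′)
      ≡⟨ cong ((a ℚ.- c) ℚ.*_) (fromℤ-* C C′) ⟩
    (a ℚ.- c) ℚ.* (fromℤ C ℚ.* fromℤ C′)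
      ≡⟨ rearranged a c (fromℤ C) (fromℤ C′) ⟩
    (a ℚ.* fromℤ C) ℚ.* fromℤ C′ ℚ.- (c ℚ.* fromℤ C′) ℚ.* fromℤ C
      ≡⟨ cong₂ (λ u v → u ℚ.* fromℤ C′ ℚ.- v ℚ.* fromℤ C) aC cC′ ⟩
    fromℤ A ℚ.* fromℤ C′ ℚ.- fromℤ A′ ℚ.* fromℤ C
      ≡⟨ cong₂ ℚ._-_ (fromℤ-* A C′) (fromℤ-* A′ C) ⟨
    fromℤ (A ℤ.* C′) ℚ.- fromℤ (A′ ℤ.* C)
      ≡⟨ fromℤ-minus (A ℤ.* C′) (A′ ℤ.* C) ⟨
    fromℤ (A ℤ.* C′ ℤ.- A′ ℤ.* C)
      ∎

represents-cross : ∀ {x A B C A′ B′ C′} → Represents x A B C → Represents x A′ B′ C′ →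
  (A ℤ.* C′ ≡ A′ ℤ.* C) × (B ℤ.* C′ ≡ B′ ℤ.* C)
represents-cross {a , b} {A} {B} {C} {A′} {B′} {C′} (represents aC bC) (represents aC′ bC′) =
  cross a A A′ aC aC′ , cross b B B′ bC bC′
  where
  open ≡-Reasoning
  swap : ∀ a x y → a ℚ.* x ℚ.* y ≡ a ℚ.* y ℚ.* x
  swap = RingSolver.solve-∀ ℚ-ring
  cross : ∀ a A A′ → a ℚ.* fromℤ C ≡ fromℤ A → a ℚ.* fromℤ C′ ≡ fromℤ A′ → A ℤ.* C′ ≡ A′ ℤ.* C
  cross a A A′ aC aC′ = fromℤ-injective (begin
    fromℤ (A ℤ.* C′)            ≡⟨ fromℤ-* A C′ ⟩
    fromℤ A ℚ.* fromℤ C′        ≡⟨ cong (ℚ._* fromℤ C′) aC ⟨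
    a ℚ.* fromℤ C ℚ.* fromℤ C′  ≡⟨ swap a (fromℤ C) (fromℤ C′) ⟩
    a ℚ.* fromℤ C′ ℚ.* fromℤ C  ≡⟨ cong (ℚ._* fromℤ C) aC′ ⟩
    fromℤ A′ ℚ.* fromℤ C        ≡⟨ fromℤ-* A′ C ⟨
    fromℤ (A′ ℤ.* C)            ∎)

module QuadraticField (D : ℤ) where

  infixl 6 _-ᴷ_
  infixl 7 _*ᴷ_

  _*ᴷ_ _-ᴷ_ : K → K → K
  _*ᴷ_ = _⊗_ D
  _-ᴷ_ = _⊖_ D

  zeroK : K
  zeroK = embed 0ℚ

  conj-* : ∀ x y → conj (x *ᴷ y) ≡ conj x *ᴷ conj y
  conj-* (a , b) (c , d) = cong₂ _,_ (real a b c d (fromℤ D)) (imaginary a b c d)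
    where
    real : ∀ a b c d δ → a ℚ.* c ℚ.+ δ ℚ.* (b ℚ.* d) ≡ a ℚ.* c ℚ.+ δ ℚ.* (ℚ.- b ℚ.* ℚ.- d)
    real = RingSolver.solve-∀ ℚ-ring
    imaginary : ∀ a b c d → ℚ.- (a ℚ.* d ℚ.+ b ℚ.* c) ≡ a ℚ.* ℚ.- d ℚ.+ ℚ.- b ℚ.* c
    imaginary = RingSolver.solve-∀ ℚ-ring

  *-identityˡ : ∀ x → oneK *ᴷ x ≡ x
  *-identityˡ (a , b) = cong₂ _,_ (real a b (fromℤ D)) (imaginary a b)
    where
    real : ∀ a b δ → ℚ.1ℚ ℚ.* a ℚ.+ δ ℚ.* (0ℚ ℚ.* b) ≡ a
    real = RingSolver.solve-∀ ℚ-ring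
    imaginary : ∀ a b → ℚ.1ℚ ℚ.* b ℚ.+ 0ℚ ℚ.* a ≡ b
    imaginary = RingSolver.solve-∀ ℚ-ring

  -ᴷ-swap : ∀ x y → y -ᴷ x ≡ zeroK -ᴷ (x -ᴷ y)
  -ᴷ-swap (a , b) (c , d) = cong₂ _,_ (swap c a) (swap d b)
    where
    swap : ∀ c a → c ℚ.- a ≡ 0ℚ ℚ.- (a ℚ.- c)
    swap = RingSolver.solve-∀ ℚ-ring

  -ᴷ-cancel : ∀ x y → x ≡ (x -ᴷ y) -ᴷ (zeroK -ᴷ y)
  -ᴷ-cancel (a , b) (c , d) = cong₂ _,_ (cancel a c) (cancel b d)
    where
    cancel : ∀ a c → a ≡ (a ℚ.- c) ℚ.- (0ℚ ℚ.- c)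
    cancel = RingSolver.solve-∀ ℚ-ring

  -ᴷ-conj-shift : ∀ x q → x -ᴷ conj x ≡ (x -ᴷ embed q) -ᴷ conj (x -ᴷ embed q)
  -ᴷ-conj-shift (a , b) q = cong₂ _,_ (real a q) (imaginary b)
    where
    real : ∀ a q → a ℚ.- a ≡ (a ℚ.- q) ℚ.- (a ℚ.- q)
    real = RingSolver.solve-∀ ℚ-ring
    imaginary : ∀ b → b ℚ.- ℚ.- b ≡ (b ℚ.- 0ℚ) ℚ.- ℚ.- (b ℚ.- 0ℚ)
    imaginary = RingSolver.solve-∀ ℚ-ring

  -ᴷ-*-distrib : ∀ y x e f → ((y -ᴷ x) *ᴷ e) *ᴷ f ≡ ((y *ᴷ f) *ᴷ e) -ᴷ ((x *ᴷ e) *ᴷ f)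
  -ᴷ-*-distrib (y₁ , y₂) (x₁ , x₂) (e₁ , e₂) (f₁ , f₂) =
    cong₂ _,_ (real y₁ y₂ x₁ x₂ e₁ e₂ f₁ f₂ (fromℤ D)) (imaginary y₁ y₂ x₁ x₂ e₁ e₂ f₁ f₂ (fromℤ D))
    where
    real : ∀ y₁ y₂ x₁ x₂ e₁ e₂ f₁ f₂ δ →
      ((y₁ ℚ.- x₁) ℚ.* e₁ ℚ.+ δ ℚ.* ((y₂ ℚ.- x₂) ℚ.* e₂)) ℚ.* f₁
        ℚ.+ δ ℚ.* (((y₁ ℚ.- x₁) ℚ.* e₂ ℚ.+ (y₂ ℚ.- x₂) ℚ.* e₁) ℚ.* f₂)
      ≡ ((y₁ ℚ.* f₁ ℚ.+ δ ℚ.* (y₂ ℚ.* f₂)) ℚ.* e₁ ℚ.+ δ ℚ.* ((y₁ ℚ.* f₂ ℚ.+ y₂ ℚ.* f₁) ℚ.* e₂))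
        ℚ.- ((x₁ ℚ.* e₁ ℚ.+ δ ℚ.* (x₂ ℚ.* e₂)) ℚ.* f₁ ℚ.+ δ ℚ.* ((x₁ ℚ.* e₂ ℚ.+ x₂ ℚ.* e₁) ℚ.* f₂))
    real = RingSolver.solve-∀ ℚ-ring
    imaginary : ∀ y₁ y₂ x₁ x₂ e₁ e₂ f₁ f₂ δ →
      ((y₁ ℚ.- x₁) ℚ.* e₁ ℚ.+ δ ℚ.* ((y₂ ℚ.- x₂) ℚ.* e₂)) ℚ.* f₂
        ℚ.+ ((y₁ ℚ.- x₁) ℚ.* e₂ ℚ.+ (y₂ ℚ.- x₂) ℚ.* e₁) ℚ.* f₁
      ≡ ((y₁ ℚ.* f₁ ℚ.+ δ ℚ.* (y₂ ℚ.* f₂)) ℚ.* e₂ ℚ.+ (y₁ ℚ.* f₂ ℚ.+ y₂ ℚ.* f₁) ℚ.* e₁)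
        ℚ.- ((x₁ ℚ.* e₁ ℚ.+ δ ℚ.* (x₂ ℚ.* e₂)) ℚ.* f₂ ℚ.+ (x₁ ℚ.* e₂ ℚ.+ x₂ ℚ.* e₁) ℚ.* f₁)
    imaginary = RingSolver.solve-∀ ℚ-ring

coprime-*ˡ : ∀ {a b c} → Coprime a c → Coprime b c → Coprime (a * b) c
coprime-*ˡ {a} {c = c} a⊥c b⊥c {d} (d∣ab , d∣c) = b⊥c (coprime-divisor d⊥a d∣ab , d∣c)
  where
  d⊥a : Coprime d a
  d⊥a (e∣d , e∣a) = a⊥c (e∣a , ℕ∣.∣-trans e∣d d∣c)

coprime-^ : ∀ {a c} → Coprime a c → ∀ k → Coprime (a ℕ.^ k) c
coprime-^ a⊥c ℕ.zero  (d∣1 , _) = ℕ∣.∣1⇒≡1 d∣1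
coprime-^ a⊥c (suc k) = coprime-*ˡ a⊥c (coprime-^ a⊥c k)

prime-∤⇒coprime : ∀ {p c} → Prime p → ¬ (p ℕ∣.∣ c) → Coprime p c
prime-∤⇒coprime p-prime p∤c (d∣p , d∣c) with prime⇒irreducible p-prime d∣p
... | inj₁ d≡1  = d≡1
... | inj₂ refl = ⊥-elim (p∤c d∣c)

coprime⇒invertible : ∀ {m c} → Coprime m c → ∃ λ u → ℤ.+ m ℤ∣.∣ ℤ.1ℤ ℤ.- ℤ.+ c ℤ.* u
coprime⇒invertible {m} {c} m⊥c with coprime-Bézout m⊥c
... | Bézout.+- x y 1+yc≡xm = ℤ.- ℤ.+ y , divides (ℤ.+ x) (begin
  ℤ.1ℤ ℤ.- ℤ.+ c ℤ.* ℤ.- ℤ.+ y  ≡⟨ rearranged (ℤ.+ c) (ℤ.+ y) ⟩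
  ℤ.1ℤ ℤ.+ ℤ.+ y ℤ.* ℤ.+ c      ≡⟨ cong (λ i → ℤ.1ℤ ℤ.+ i) (ℤP.pos-* y c) ⟨
  ℤ.+ (1 ℕ.+ y * c)            ≡⟨ cong ℤ.+_ 1+yc≡xm ⟩
  ℤ.+ (x * m)                  ≡⟨ ℤP.pos-* x m ⟩
  ℤ.+ x ℤ.* ℤ.+ m              ∎)
  where
  open ≡-Reasoning
  rearranged : ∀ c y → ℤ.1ℤ ℤ.- c ℤ.* ℤ.- y ≡ ℤ.1ℤ ℤ.+ y ℤ.* c
  rearranged = solve-∀
... | Bézout.-+ x y 1+xm≡yc = ℤ.+ y , divides (ℤ.- ℤ.+ x) (begin
  ℤ.1ℤ ℤ.- ℤ.+ c ℤ.* ℤ.+ y             ≡⟨ cong (λ i → ℤ.1ℤ ℤ.- i) (ℤP.*-comm (ℤ.+ c) (ℤ.+ y)) ⟩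
  ℤ.1ℤ ℤ.- ℤ.+ y ℤ.* ℤ.+ c             ≡⟨ cong (λ i → ℤ.1ℤ ℤ.- i) (ℤP.pos-* y c) ⟨
  ℤ.1ℤ ℤ.- ℤ.+ (y * c)                 ≡⟨ cong (λ i → ℤ.1ℤ ℤ.- ℤ.+ i) 1+xm≡yc ⟨
  ℤ.1ℤ ℤ.- ℤ.+ (1 ℕ.+ x * m)           ≡⟨ cong (λ i → ℤ.1ℤ ℤ.- (ℤ.1ℤ ℤ.+ i)) (ℤP.pos-* x m) ⟩
  ℤ.1ℤ ℤ.- (ℤ.1ℤ ℤ.+ ℤ.+ x ℤ.* ℤ.+ m)  ≡⟨ rearranged (ℤ.+ x) (ℤ.+ m) ⟩
  ℤ.- ℤ.+ x ℤ.* ℤ.+ m                  ∎)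
  where
  open ≡-Reasoning
  rearranged : ∀ x m → ℤ.1ℤ ℤ.- (ℤ.1ℤ ℤ.+ x ℤ.* m) ≡ ℤ.- x ℤ.* m
  rearranged = solve-∀

failure-boundary : ∀ {Q : ℕ → Set} → Decidable Q → Q 0 → ∀ n → ¬ Q n →
                   ∃ λ s → s < n × Q s × ¬ Q (suc s)
failure-boundary Q? q₀ ℕ.zero  ¬qₙ = ⊥-elim (¬qₙ q₀)
failure-boundary Q? q₀ (suc n) ¬qₙ₊₁ with Q? n
... | yes qₙ = n , ℕP.≤-refl , qₙ , ¬qₙ₊₁
... | no ¬qₙ with failure-boundary Q? q₀ n ¬qₙ
...   | s , s<n , qₛ , ¬qₛ₊₁ = s , ℕP.m<n⇒m<1+n s<n , qₛ , ¬qₛ₊₁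

m<n+j⇒m+i≤n : ∀ {m n} i j → i ℕ.+ j ≡ 1 → m < n ℕ.+ j → m ℕ.+ i ℕ.≤ n
m<n+j⇒m+i≤n {m} {n} ℕ.zero _ refl m<n+1 =
  subst (ℕ._≤ n) (sym (ℕP.+-identityʳ m)) (ℕP.≤-pred (subst (suc m ℕ.≤_) (ℕP.+-comm n 1) m<n+1))
m<n+j⇒m+i≤n {m} {n} (suc ℕ.zero) _ refl m<n+0 =
  subst₂ ℕ._≤_ (ℕP.+-comm 1 m) (ℕP.+-identityʳ n) m<n+0

∣x-x : ∀ i x → i ℤ∣.∣ x ℤ.- x
∣x-x i x = divides ℤ.0ℤ (trans (ℤP.+-inverseʳ x) (sym (ℤP.*-zeroˡ i)))

∣-telescope : ∀ {i} x y z → i ℤ∣.∣ x ℤ.- y → i ℤ∣.∣ y ℤ.- z → i ℤ∣.∣ x ℤ.- z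
∣-telescope {i} x y z i∣x-y i∣y-z = subst (i ℤ∣.∣_) (telescope x y z) (ℤ∣.∣m∣n⇒∣m+n i∣x-y i∣y-z)
  where
  telescope : ∀ x y z → (x ℤ.- y) ℤ.+ (y ℤ.- z) ≡ x ℤ.- z
  telescope = solve-∀

∣-diff-sym : ∀ {i} x y → i ℤ∣.∣ x ℤ.- y → i ℤ∣.∣ y ℤ.- x
∣-diff-sym {i} x y i∣x-y = subst (i ℤ∣.∣_) (negated x y) (ℤ∣.∣m⇒∣-m i∣x-y)
  where
  negated : ∀ x y → ℤ.- (x ℤ.- y) ≡ y ℤ.- x
  negated = solve-∀

module PrimePowers {p : ℕ} (p-prime : Prime p) where

  instance
    p≢0 : ℕ.NonZero p
    p≢0 = prime⇒nonZero p-prime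

  1<p : 1 < p
  1<p = ℕ.nonTrivial⇒n>1 p {{prime⇒nonTrivial p-prime}}

  p∤1 : ¬ (p ℕ∣.∣ 1)
  p∤1 p∣1 = ℕP.<-irrefl refl (subst (1 <_) (ℕ∣.∣1⇒≡1 p∣1) 1<p)

  pow-+ : ∀ a b → pow p (a ℕ.+ b) ≡ pow p a ℤ.* pow p b
  pow-+ a b = trans (cong ℤ.+_ (ℕP.^-distribˡ-+-* p a b)) (ℤP.pos-* (p ℕ.^ a) (p ℕ.^ b))

  pow-∣ : ∀ {a b} → a ℕ.≤ b → pow p a ℤ∣.∣ pow p b
  pow-∣ {a} a≤b with ℕP.m≤n⇒∃[o]m+o≡n a≤b
  ... | o , refl = divides (pow p o) (trans (pow-+ a o) (ℤP.*-comm (pow p a) (pow p o)))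

  pow-zero-∣ : ∀ x → pow p 0 ℤ∣.∣ x
  pow-zero-∣ x = divides x (sym (ℤP.*-identityʳ x))

  PAdicUnit : ℤ → Set
  PAdicUnit c = ¬ (p ℕ∣.∣ ℤ.∣ c ∣)

  factor-p-powerℕ : ∀ n → Acc _<_ n → n ≢ 0 → ∃₂ λ t c → n ≡ p ℕ.^ t * c × ¬ (p ℕ∣.∣ c)
  factor-p-powerℕ n (acc rec) n≢0 with p ℕ∣.∣? n
  ... | no p∤n = 0 , n , sym (ℕP.+-identityʳ n) , p∤n
  ... | yes (ℕ∣.divides q refl) with factor-p-powerℕ q (rec q<q*p) q≢0
    where
    q≢0 : q ≢ 0
    q≢0 refl = n≢0 refl
    q<q*p : q < q * p
    q<q*p = ℕP.m<m*n q p {{ℕ.≢-nonZero q≢0}} 1<p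
  ...   | t , c , refl , p∤c = suc t , c , reassociate (p ℕ.^ t) c p , p∤c
    where
    reassociate : ∀ a c p → a * c * p ≡ p * a * c
    reassociate = ℕSolver.solve-∀

  factor-p-power : ∀ C → C ≢ ℤ.0ℤ → ∃₂ λ t c → C ≡ pow p t ℤ.* c × PAdicUnit c
  factor-p-power (ℤ.+ ℕ.zero) C≢0 = ⊥-elim (C≢0 refl)
  factor-p-power (ℤ.+ suc n) _ with factor-p-powerℕ (suc n) (<-wellFounded (suc n)) (λ ())
  ... | t , c , n≡ , p∤c = t , ℤ.+ c , trans (cong ℤ.+_ n≡) (ℤP.pos-* (p ℕ.^ t) c) , p∤c
  factor-p-power ℤ.-[1+ n ] _ with factor-p-powerℕ (suc n) (<-wellFounded (suc n)) (λ ())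
  ... | t , c , n≡ , p∤c = t , ℤ.- ℤ.+ c , C≡ , p∤c ∘ subst (p ℕ∣.∣_) (ℤP.∣-i∣≡∣i∣ (ℤ.+ c))
    where
    C≡ : ℤ.-[1+ n ] ≡ pow p t ℤ.* ℤ.- ℤ.+ c
    C≡ = trans (cong (λ m → ℤ.- ℤ.+ m) n≡)
               (trans (cong ℤ.-_ (ℤP.pos-* (p ℕ.^ t) c)) (ℤP.neg-distribʳ-* (pow p t) (ℤ.+ c)))

  unit-coprime : ∀ {c} → PAdicUnit c → ∀ k → Coprime (p ℕ.^ k) ℤ.∣ c ∣
  unit-coprime p∤c = coprime-^ (prime-∤⇒coprime p-prime p∤c)

  unit-cancel : ∀ {c k Y} → PAdicUnit c → pow p k ℤ∣.∣ c ℤ.* Y → pow p k ℤ∣.∣ Y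
  unit-cancel {c} {k} {Y} p∤c p^k∣cY = ℤ∣.∣ᵤ⇒∣ (coprime-divisor (unit-coprime {c} p∤c k)
    (subst (p ℕ.^ k ℕ∣.∣_) (ℤP.abs-* c Y) (ℤ∣.∣⇒∣ᵤ p^k∣cY)))

  pow-unit-cancel : ∀ {c k t Y} → PAdicUnit c →
                    pow p (k ℕ.+ t) ℤ∣.∣ (pow p t ℤ.* c) ℤ.* Y → pow p k ℤ∣.∣ Y
  pow-unit-cancel {c} {k} {t} {Y} p∤c h = unit-cancel {c} {k} p∤c
    (ℤ∣.*-cancelˡ-∣ (pow p t) {{ℕP.m^n≢0 p t}}
      (subst₂ ℤ∣._∣_ (trans (pow-+ k t) (ℤP.*-comm (pow p k) (pow p t)))
                     (ℤP.*-assoc (pow p t) c Y) h))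

  unit-inverse : ∀ {c} → PAdicUnit c → ∀ k → ∃ λ v → pow p k ℤ∣.∣ ℤ.1ℤ ℤ.- c ℤ.* v
  unit-inverse {c} p∤c k with coprime⇒invertible (unit-coprime {c} p∤c k) | ℤP.+∣i∣≡i⊎+∣i∣≡-i c
  ... | v , inverse | inj₁ ∣c∣≡c  = v , subst (λ c → pow p k ℤ∣.∣ ℤ.1ℤ ℤ.- c ℤ.* v) ∣c∣≡c inverse
  ... | v , inverse | inj₂ ∣c∣≡-c = ℤ.- v , subst (pow p k ℤ∣.∣_) (sign-moved c v)
    (subst (λ c′ → pow p k ℤ∣.∣ ℤ.1ℤ ℤ.- c′ ℤ.* v) ∣c∣≡-c inverse)
    where
    sign-moved : ∀ c v → ℤ.1ℤ ℤ.- ℤ.- c ℤ.* v ≡ ℤ.1ℤ ℤ.- c ℤ.* ℤ.- v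
    sign-moved = solve-∀

  unit-solve : ∀ {c} → PAdicUnit c → ∀ k w → ∃ λ z → pow p k ℤ∣.∣ w ℤ.- c ℤ.* z
  unit-solve {c} p∤c k w with unit-inverse {c} p∤c k
  ... | v , inverse = v ℤ.* w , subst (pow p k ℤ∣.∣_) (distributed w c v) (ℤ∣.∣n⇒∣m*n w inverse)
    where
    distributed : ∀ w c v → w ℤ.* (ℤ.1ℤ ℤ.- c ℤ.* v) ≡ w ℤ.- c ℤ.* (v ℤ.* w)
    distributed = solve-∀

module Valuation {p : ℕ} (p-prime : Prime p) (D : ℤ) (r : ℕ → ℤ) (sqrt : IsSqrtSeq p D r) where

  open PrimePowers p-prime
  open QuadraticField D using (_-ᴷ_; zeroK; -ᴷ-swap)

  r-coherent : ∀ {k j} → k ℕ.≤ j → pow p k ℤ∣.∣ r j ℤ.- r k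
  r-coherent {k} {j} k≤j with ℕP.m≤n⇒m<n∨m≡n k≤j
  r-coherent {k} {ℕ.zero} _ | inj₁ ()
  r-coherent {k} {suc j}  _ | inj₁ (ℕ.s≤s k≤j) = ∣-telescope (r (suc j)) (r j) (r k)
    (ℤ∣.∣-trans (pow-∣ k≤j) (ℤ∣.∣ᵤ⇒∣ (proj₁ sqrt j))) (r-coherent k≤j)
  r-coherent {k} {_}      _ | inj₂ refl = ∣x-x (pow p k) (r k)

  -- A + B r_k approximates A + Bω modulo p^k.
  approx : ℤ → ℤ → ℕ → ℤ
  approx A B k = A ℤ.+ B ℤ.* r k

  approx-coherent : ∀ A B {k j} → k ℕ.≤ j → pow p k ℤ∣.∣ approx A B j ℤ.- approx A B k
  approx-coherent A B {k} {j} k≤j =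
    subst (pow p k ℤ∣.∣_) (distributed A B (r j) (r k)) (ℤ∣.∣n⇒∣m*n B (r-coherent k≤j))
    where
    distributed : ∀ A B x y → B ℤ.* (x ℤ.- y) ≡ (A ℤ.+ B ℤ.* x) ℤ.- (A ℤ.+ B ℤ.* y)
    distributed = solve-∀

  ∣-approx-transfer : ∀ A B {k j j′} → k ℕ.≤ j → k ℕ.≤ j′ →
                      pow p k ℤ∣.∣ approx A B j → pow p k ℤ∣.∣ approx A B j′
  ∣-approx-transfer A B {k} {j} {j′} k≤j k≤j′ k∣j = ℤ∣.∣m+n∣n⇒∣m
    (∣-telescope (approx A B j′) (approx A B k) (approx A B j) (approx-coherent A B k≤j′)
                 (∣-diff-sym (approx A B j) (approx A B k) (approx-coherent A B k≤j)))
    (ℤ∣.∣m⇒∣-m k∣j)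

  ValGeℤ : ℕ → ℤ → ℤ → ℤ → Set
  ValGeℤ m A B C = ∀ k → ∃ λ z → pow p k ℤ∣.∣ approx A B k ℤ.- (C ℤ.* pow p m) ℤ.* z

  valGeℤ⇒∣ : ∀ m A B t c → ValGeℤ m A B (pow p t ℤ.* c) →
             pow p (t ℕ.+ m) ℤ∣.∣ approx A B (t ℕ.+ m)
  valGeℤ⇒∣ m A B t c h with h (t ℕ.+ m)
  ... | z , d = ℤ∣.∣m+n∣n⇒∣m d (ℤ∣.∣m⇒∣-m (divides (c ℤ.* z) regrouped))
    where
    regroup : ∀ a c b z → (a ℤ.* c ℤ.* b) ℤ.* z ≡ (c ℤ.* z) ℤ.* (a ℤ.* b)
    regroup = solve-∀
    regrouped : (pow p t ℤ.* c ℤ.* pow p m) ℤ.* z ≡ (c ℤ.* z) ℤ.* pow p (t ℕ.+ m)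
    regrouped = trans (regroup (pow p t) c (pow p m) z) (cong ((c ℤ.* z) ℤ.*_) (sym (pow-+ t m)))

  ∣⇒valGeℤ : ∀ m A B t c → PAdicUnit c → pow p (t ℕ.+ m) ℤ∣.∣ approx A B (t ℕ.+ m) →
             ValGeℤ m A B (pow p t ℤ.* c)
  ∣⇒valGeℤ m A B t c p∤c d k =
    z , ∣-telescope (approx A B k) (approx A B N) (X ℤ.* z)
          (∣-diff-sym (approx A B N) (approx A B k) (approx-coherent A B (ℕP.m≤m+n k (t ℕ.+ m))))
          (subst (pow p k ℤ∣.∣_) (sym factored) (ℤ∣.∣m⇒∣m*n (pow p t ℤ.* pow p m) k∣w-cz))
    where
    open ≡-Reasoning
    N : ℕ
    N = k ℕ.+ (t ℕ.+ m)
    X : ℤ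
    X = pow p t ℤ.* c ℤ.* pow p m
    d-N : pow p (t ℕ.+ m) ℤ∣.∣ approx A B N
    d-N = ∣-approx-transfer A B ℕP.≤-refl (ℕP.m≤n+m (t ℕ.+ m) k) d
    w z : ℤ
    w = quotient d-N
    z = proj₁ (unit-solve {c} p∤c k w)
    k∣w-cz : pow p k ℤ∣.∣ w ℤ.- c ℤ.* z
    k∣w-cz = proj₂ (unit-solve {c} p∤c k w)
    factor : ∀ w a c b z → w ℤ.* (a ℤ.* b) ℤ.- (a ℤ.* c ℤ.* b) ℤ.* z ≡ (w ℤ.- c ℤ.* z) ℤ.* (a ℤ.* b)
    factor = solve-∀
    factored : approx A B N ℤ.- X ℤ.* z ≡ (w ℤ.- c ℤ.* z) ℤ.* (pow p t ℤ.* pow p m)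
    factored = begin
      approx A B N ℤ.- X ℤ.* z                   ≡⟨ cong (ℤ._- X ℤ.* z) (ℤ∣._∣_.equality d-N) ⟩
      w ℤ.* pow p (t ℕ.+ m) ℤ.- X ℤ.* z          ≡⟨ cong (λ q → w ℤ.* q ℤ.- X ℤ.* z) (pow-+ t m) ⟩
      w ℤ.* (pow p t ℤ.* pow p m) ℤ.- X ℤ.* z    ≡⟨ factor w (pow p t) c (pow p m) z ⟩
      (w ℤ.- c ℤ.* z) ℤ.* (pow p t ℤ.* pow p m)  ∎

  valGeℤ? : ∀ m A B C → C ≢ ℤ.0ℤ → Dec (ValGeℤ m A B C)
  valGeℤ? m A B C C≢0 with factor-p-power C C≢0
  ... | t , c , refl , p∤c with pow p (t ℕ.+ m) ℤ∣.∣? approx A B (t ℕ.+ m)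
  ...   | yes d = yes (∣⇒valGeℤ m A B t c p∤c d)
  ...   | no ¬d = no (¬d ∘ valGeℤ⇒∣ m A B t c)

  -- The product of the approximations differs from the approximation of the product
  -- by B B′ (r_k² − D), which p^k divides.
  valGeℤ-* : ∀ m m′ A B C A′ B′ C′ → ValGeℤ m A B C → ValGeℤ m′ A′ B′ C′ →
    ValGeℤ (m ℕ.+ m′) (A ℤ.* A′ ℤ.+ D ℤ.* (B ℤ.* B′)) (A ℤ.* B′ ℤ.+ B ℤ.* A′) (C ℤ.* C′)
  valGeℤ-* m m′ A B C A′ B′ C′ h h′ k with h k | h′ k
  ... | z , d | z′ , d′ = z ℤ.* z′ , subst (pow p k ℤ∣.∣_) (sym expanded) divisible
    where
    x e e′ : ℤ
    x = r k
    e = approx A B k ℤ.- (C ℤ.* pow p m) ℤ.* z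
    e′ = approx A′ B′ k ℤ.- (C′ ℤ.* pow p m′) ℤ.* z′
    divisible : pow p k ℤ∣.∣ e ℤ.* approx A′ B′ k ℤ.+ ((C ℤ.* pow p m) ℤ.* z) ℤ.* e′
                               ℤ.- (B ℤ.* B′) ℤ.* (x ℤ.* x ℤ.- D)
    divisible = ℤ∣.∣m∣n⇒∣m-n (ℤ∣.∣m∣n⇒∣m+n (ℤ∣.∣m⇒∣m*n (approx A′ B′ k) d)
                                             (ℤ∣.∣n⇒∣m*n ((C ℤ.* pow p m) ℤ.* z) d′))
                              (ℤ∣.∣n⇒∣m*n (B ℤ.* B′) (ℤ∣.∣ᵤ⇒∣ (proj₂ sqrt k)))
    identity : ∀ A B C A′ B′ C′ D x q q′ z z′ →
      (A ℤ.* A′ ℤ.+ D ℤ.* (B ℤ.* B′)) ℤ.+ (A ℤ.* B′ ℤ.+ B ℤ.* A′) ℤ.* x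
        ℤ.- (C ℤ.* C′ ℤ.* (q ℤ.* q′)) ℤ.* (z ℤ.* z′)
      ≡ ((A ℤ.+ B ℤ.* x) ℤ.- (C ℤ.* q) ℤ.* z) ℤ.* (A′ ℤ.+ B′ ℤ.* x)
        ℤ.+ ((C ℤ.* q) ℤ.* z) ℤ.* ((A′ ℤ.+ B′ ℤ.* x) ℤ.- (C′ ℤ.* q′) ℤ.* z′)
        ℤ.- (B ℤ.* B′) ℤ.* (x ℤ.* x ℤ.- D)
    identity = solve-∀
    expanded : approx (A ℤ.* A′ ℤ.+ D ℤ.* (B ℤ.* B′)) (A ℤ.* B′ ℤ.+ B ℤ.* A′) k
                 ℤ.- (C ℤ.* C′ ℤ.* pow p (m ℕ.+ m′)) ℤ.* (z ℤ.* z′)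
               ≡ e ℤ.* approx A′ B′ k ℤ.+ ((C ℤ.* pow p m) ℤ.* z) ℤ.* e′
                 ℤ.- (B ℤ.* B′) ℤ.* (x ℤ.* x ℤ.- D)
    expanded = trans (cong (λ q → approx (A ℤ.* A′ ℤ.+ D ℤ.* (B ℤ.* B′)) (A ℤ.* B′ ℤ.+ B ℤ.* A′) k
                                    ℤ.- (C ℤ.* C′ ℤ.* q) ℤ.* (z ℤ.* z′)) (pow-+ m m′))
                     (identity A B C A′ B′ C′ D x (pow p m) (pow p m′) z z′)

  valGeℤ-− : ∀ m A B C A′ B′ C′ → ValGeℤ m A B C → ValGeℤ m A′ B′ C′ →
    ValGeℤ m (A ℤ.* C′ ℤ.- A′ ℤ.* C) (B ℤ.* C′ ℤ.- B′ ℤ.* C) (C ℤ.* C′)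
  valGeℤ-− m A B C A′ B′ C′ h h′ k with h k | h′ k
  ... | z , d | z′ , d′ = z ℤ.- z′ ,
    subst (pow p k ℤ∣.∣_) (sym (identity A B C A′ B′ C′ (r k) (pow p m) z z′))
          (ℤ∣.∣m∣n⇒∣m-n (ℤ∣.∣n⇒∣m*n C′ d) (ℤ∣.∣n⇒∣m*n C d′))
    where
    identity : ∀ A B C A′ B′ C′ x q z z′ →
      (A ℤ.* C′ ℤ.- A′ ℤ.* C) ℤ.+ (B ℤ.* C′ ℤ.- B′ ℤ.* C) ℤ.* x ℤ.- (C ℤ.* C′ ℤ.* q) ℤ.* (z ℤ.- z′)
      ≡ C′ ℤ.* ((A ℤ.+ B ℤ.* x) ℤ.- (C ℤ.* q) ℤ.* z)
        ℤ.- C ℤ.* ((A′ ℤ.+ B′ ℤ.* x) ℤ.- (C′ ℤ.* q) ℤ.* z′)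
    identity = solve-∀

  valGeℤ-cross : ∀ m A B C A′ B′ C′ → C ≢ ℤ.0ℤ → A ℤ.* C′ ≡ A′ ℤ.* C → B ℤ.* C′ ≡ B′ ℤ.* C →
                 ValGeℤ m A B C → ValGeℤ m A′ B′ C′
  valGeℤ-cross m A B C A′ B′ C′ C≢0 AC′≡A′C BC′≡B′C h k with factor-p-power C C≢0
  ... | t , c , refl , p∤c with h (k ℕ.+ t)
  ... | z , d = z , ∣-telescope (approx A′ B′ k) (approx A′ B′ j) ((C′ ℤ.* pow p m) ℤ.* z)
    (∣-diff-sym (approx A′ B′ j) (approx A′ B′ k) (approx-coherent A′ B′ (ℕP.m≤m+n k t)))
    (pow-unit-cancel {c} {k} {t} p∤c (subst (pow p j ℤ∣.∣_) (sym scaled) (ℤ∣.∣n⇒∣m*n C′ d)))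
    where
    open ≡-Reasoning
    j : ℕ
    j = k ℕ.+ t
    expand : ∀ A B C x q z →
      C ℤ.* ((A ℤ.+ B ℤ.* x) ℤ.- q ℤ.* z) ≡ A ℤ.* C ℤ.+ B ℤ.* C ℤ.* x ℤ.- C ℤ.* q ℤ.* z
    expand = solve-∀
    commute : ∀ C C′ q → C ℤ.* (C′ ℤ.* q) ≡ C′ ℤ.* (C ℤ.* q)
    commute = solve-∀
    scaled : C ℤ.* (approx A′ B′ j ℤ.- (C′ ℤ.* pow p m) ℤ.* z)
             ≡ C′ ℤ.* (approx A B j ℤ.- (C ℤ.* pow p m) ℤ.* z)
    scaled = begin
      C ℤ.* (approx A′ B′ j ℤ.- (C′ ℤ.* pow p m) ℤ.* z)
        ≡⟨ expand A′ B′ C (r j) (C′ ℤ.* pow p m) z ⟩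
      A′ ℤ.* C ℤ.+ B′ ℤ.* C ℤ.* r j ℤ.- C ℤ.* (C′ ℤ.* pow p m) ℤ.* z
        ≡⟨ cong₂ (λ a b → a ℤ.+ b ℤ.* r j ℤ.- C ℤ.* (C′ ℤ.* pow p m) ℤ.* z)
                 (sym AC′≡A′C) (sym BC′≡B′C) ⟩
      A ℤ.* C′ ℤ.+ B ℤ.* C′ ℤ.* r j ℤ.- C ℤ.* (C′ ℤ.* pow p m) ℤ.* z
        ≡⟨ cong (λ q → A ℤ.* C′ ℤ.+ B ℤ.* C′ ℤ.* r j ℤ.- q ℤ.* z) (commute C C′ (pow p m)) ⟩
      A ℤ.* C′ ℤ.+ B ℤ.* C′ ℤ.* r j ℤ.- C′ ℤ.* (C ℤ.* pow p m) ℤ.* z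
        ≡⟨ expand A B C′ (r j) (C ℤ.* pow p m) z ⟨
      C′ ℤ.* (approx A B j ℤ.- (C ℤ.* pow p m) ℤ.* z)
        ∎

  valGeℤ-pred : ∀ m A B C → ValGeℤ (suc m) A B C → ValGeℤ m A B C
  valGeℤ-pred m A B C h k with h k
  ... | z , d = ℤ.+ p ℤ.* z , subst (λ y → pow p k ℤ∣.∣ approx A B k ℤ.- y) regrouped d
    where
    regroup : ∀ C q P z → (C ℤ.* (q ℤ.* P)) ℤ.* z ≡ (C ℤ.* P) ℤ.* (q ℤ.* z)
    regroup = solve-∀
    regrouped : (C ℤ.* pow p (suc m)) ℤ.* z ≡ (C ℤ.* pow p m) ℤ.* (ℤ.+ p ℤ.* z)
    regrouped = trans (cong (λ q → (C ℤ.* q) ℤ.* z) (ℤP.pos-* p (p ℕ.^ m)))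
                      (regroup C (ℤ.+ p) (pow p m) z)

  ¬valGeℤ-one : ¬ ValGeℤ 1 ℤ.1ℤ ℤ.0ℤ ℤ.1ℤ
  ¬valGeℤ-one h =
    p∤1 (subst (ℕ∣._∣ 1) (ℕP.*-identityʳ p) (ℤ∣.∣⇒∣ᵤ (valGeℤ⇒∣ 1 ℤ.1ℤ ℤ.0ℤ 0 ℤ.1ℤ h)))

  -- v(A + Bω) = s
  ExactValuation : ℤ → ℤ → ℕ → Set
  ExactValuation A B s = ∀ N → s < N → ∃ λ v → PAdicUnit v × approx A B N ≡ v ℤ.* pow p s

  exact-valuation : ∀ A B M → ¬ (pow p M ℤ∣.∣ approx A B M) → ∃ λ s → s < M × ExactValuation A B s
  exact-valuation A B M ¬p^M∣ with failure-boundary {λ n → pow p n ℤ∣.∣ approx A B n}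
    (λ n → pow p n ℤ∣.∣? approx A B n) (pow-zero-∣ (approx A B 0)) M ¬p^M∣
  ... | s , s<M , p^s∣ , ¬p^s+1∣ = s , s<M , unit-part
    where
    unit-part : ExactValuation A B s
    unit-part N s<N = v , p∤v , ℤ∣._∣_.equality p^s∣N
      where
      p^s∣N : pow p s ℤ∣.∣ approx A B N
      p^s∣N = ∣-approx-transfer A B ℕP.≤-refl (ℕP.<⇒≤ s<N) p^s∣
      v : ℤ
      v = quotient p^s∣N
      p∤v : PAdicUnit v
      p∤v p∣v = ¬p^s+1∣ (∣-approx-transfer A B s<N ℕP.≤-refl
        (subst₂ ℤ∣._∣_ (sym (pow-+ 1 s)) (sym (ℤ∣._∣_.equality p^s∣N))
          (ℤ∣.*-monoˡ-∣ (pow p s) {pow p 1} {v}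
            (ℤ∣.∣ᵤ⇒∣ (subst (ℕ∣._∣ ℤ.∣ v ∣) (sym (ℕP.*-identityʳ p)) p∣v)))))

  -- (A′ + B′√D)(A + B√D) = C′C, read modulo p^N
  norm-congruence : ∀ A B C A′ B′ C′ →
    A′ ℤ.* A ℤ.+ D ℤ.* (B′ ℤ.* B) ≡ C′ ℤ.* C → A′ ℤ.* B ℤ.+ B′ ℤ.* A ≡ ℤ.0ℤ →
    ∀ N → pow p N ℤ∣.∣ approx A′ B′ N ℤ.* approx A B N ℤ.- C′ ℤ.* C
  norm-congruence A B C A′ B′ C′ real imaginary N =
    subst (pow p N ℤ∣.∣_) (sym (identity A B C A′ B′ C′ D (r N)))
      (ℤ∣.∣m∣n⇒∣m+n (ℤ∣.∣m∣n⇒∣m+n (ℤ∣.∣n⇒∣m*n (B′ ℤ.* B) (ℤ∣.∣ᵤ⇒∣ (proj₂ sqrt N))) real-part)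
                    imaginary-part)
    where
    identity : ∀ A B C A′ B′ C′ D x →
      (A′ ℤ.+ B′ ℤ.* x) ℤ.* (A ℤ.+ B ℤ.* x) ℤ.- C′ ℤ.* C
      ≡ (B′ ℤ.* B) ℤ.* (x ℤ.* x ℤ.- D) ℤ.+ ((A′ ℤ.* A ℤ.+ D ℤ.* (B′ ℤ.* B)) ℤ.- C′ ℤ.* C)
        ℤ.+ (A′ ℤ.* B ℤ.+ B′ ℤ.* A) ℤ.* x
    identity = solve-∀
    real-part : pow p N ℤ∣.∣ (A′ ℤ.* A ℤ.+ D ℤ.* (B′ ℤ.* B)) ℤ.- C′ ℤ.* C
    real-part = subst (λ y → pow p N ℤ∣.∣ y ℤ.- C′ ℤ.* C) (sym real) (∣x-x (pow p N) (C′ ℤ.* C))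
    imaginary-part : pow p N ℤ∣.∣ (A′ ℤ.* B ℤ.+ B′ ℤ.* A) ℤ.* r N
    imaginary-part = ℤ∣.∣m⇒∣m*n (r N) (subst (pow p N ℤ∣.∣_) (sym imaginary) (divides ℤ.0ℤ refl))

  -- With s = v(A + Bω) < t + j, the norm congruence modulo p^N for large N forces
  -- v(A′ + B′ω) ≥ t + t′ − s ≥ t′ + i.
  valGeℤ-inverse : ∀ i j A B C A′ B′ C′ → i ℕ.+ j ≡ 1 → C ≢ ℤ.0ℤ → C′ ≢ ℤ.0ℤ →
    A′ ℤ.* A ℤ.+ D ℤ.* (B′ ℤ.* B) ≡ C′ ℤ.* C → A′ ℤ.* B ℤ.+ B′ ℤ.* A ≡ ℤ.0ℤ →
    ¬ ValGeℤ j A B C → ValGeℤ i A′ B′ C′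
  valGeℤ-inverse i j A B C A′ B′ C′ i+j≡1 C≢0 C′≢0 real imaginary ¬vⱼ
    with factor-p-power C C≢0 | factor-p-power C′ C′≢0
  ... | t , c , C≡ , p∤c | t′ , c′ , C′≡ , p∤c′ = from-exact (exact-valuation A B (t ℕ.+ j) ¬p^t+j∣)
    where
    ¬p^t+j∣ : ¬ (pow p (t ℕ.+ j) ℤ∣.∣ approx A B (t ℕ.+ j))
    ¬p^t+j∣ = ¬vⱼ ∘ subst (ValGeℤ j A B) (sym C≡) ∘ ∣⇒valGeℤ j A B t c p∤c
    from-exact : (∃ λ s → s < t ℕ.+ j × ExactValuation A B s) → ValGeℤ i A′ B′ C′
    from-exact (s , s<t+j , unit-part) = subst (ValGeℤ i A′ B′) (sym C′≡)
      (∣⇒valGeℤ i A′ B′ t′ c′ p∤c′ (∣-approx-transfer A′ B′ t′+i≤N ℕP.≤-refl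
        (pow-unit-cancel {v} {t′ ℕ.+ i} {s} p∤v p^M∣product)))
      where
      N M : ℕ
      N = suc (t ℕ.+ t′)
      M = t′ ℕ.+ i ℕ.+ s
      s+i≤t : s ℕ.+ i ℕ.≤ t
      s+i≤t = m<n+j⇒m+i≤n i j i+j≡1 s<t+j
      M≤t+t′ : M ℕ.≤ t ℕ.+ t′
      M≤t+t′ = begin
        t′ ℕ.+ i ℕ.+ s    ≡⟨ ℕP.+-assoc t′ i s ⟩
        t′ ℕ.+ (i ℕ.+ s)  ≡⟨ cong (t′ ℕ.+_) (ℕP.+-comm i s) ⟩
        t′ ℕ.+ (s ℕ.+ i)  ≤⟨ ℕP.+-monoʳ-≤ t′ s+i≤t ⟩
        t′ ℕ.+ t          ≡⟨ ℕP.+-comm t′ t ⟩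
        t ℕ.+ t′          ∎
        where open ℕP.≤-Reasoning
      s<N : s < N
      s<N = ℕ.s≤s (ℕP.≤-trans (ℕP.≤-trans (ℕP.m≤m+n s i) s+i≤t) (ℕP.m≤m+n t t′))
      v : ℤ
      v = proj₁ (unit-part N s<N)
      p∤v : PAdicUnit v
      p∤v = proj₁ (proj₂ (unit-part N s<N))
      t′+i≤N : t′ ℕ.+ i ℕ.≤ N
      t′+i≤N = ℕP.≤-trans (ℕP.m≤m+n (t′ ℕ.+ i) s) (ℕP.m≤n⇒m≤1+n M≤t+t′)
      p^M∣C′C : pow p M ℤ∣.∣ C′ ℤ.* C
      p^M∣C′C = ℤ∣.∣-trans (pow-∣ M≤t+t′) (divides (c′ ℤ.* c)
        (trans (cong₂ ℤ._*_ C′≡ C≡)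
          (trans (regroup (pow p t′) c′ (pow p t) c) (cong ((c′ ℤ.* c) ℤ.*_) (sym (pow-+ t t′))))))
        where
        regroup : ∀ a c′ b c → (a ℤ.* c′) ℤ.* (b ℤ.* c) ≡ (c′ ℤ.* c) ℤ.* (b ℤ.* a)
        regroup = solve-∀
      p^M∣norm : pow p M ℤ∣.∣ approx A′ B′ N ℤ.* approx A B N
      p^M∣norm = ℤ∣.∣m+n∣n⇒∣m
        (ℤ∣.∣-trans (pow-∣ (ℕP.m≤n⇒m≤1+n M≤t+t′))
                    (norm-congruence A B C A′ B′ C′ real imaginary N))
        (ℤ∣.∣m⇒∣-m p^M∣C′C)
      p^M∣product : pow p (t′ ℕ.+ i ℕ.+ s) ℤ∣.∣ (pow p s ℤ.* v) ℤ.* approx A′ B′ N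
      p^M∣product = subst (pow p M ℤ∣.∣_)
        (trans (cong (approx A′ B′ N ℤ.*_) (proj₂ (proj₂ (unit-part N s<N))))
               (regroup (approx A′ B′ N) v (pow p s)))
        p^M∣norm
        where
        regroup : ∀ a v q → a ℤ.* (v ℤ.* q) ≡ (q ℤ.* v) ℤ.* a
        regroup = solve-∀

  valGe⇒valGeℤ : ∀ m x → ValGe p r m x → ValGeℤ m (canonA x) (canonB x) (canonC x)
  valGe⇒valGeℤ m (a , b) h = map₂ ℤ∣.∣ᵤ⇒∣ ∘ h

  valGeℤ⇒valGe : ∀ m x → ValGeℤ m (canonA x) (canonB x) (canonC x) → ValGe p r m x
  valGeℤ⇒valGe m (a , b) h = map₂ ℤ∣.∣⇒∣ᵤ ∘ h

  represents⇒valGe : ∀ m x A B C → Represents x A B C → C ≢ ℤ.0ℤ → ValGeℤ m A B C → ValGe p r m x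
  represents⇒valGe m x A B C x≈ABC C≢0 h = valGeℤ⇒valGe m x
    (valGeℤ-cross m A B C (canonA x) (canonB x) (canonC x) C≢0 (proj₁ cross) (proj₂ cross) h)
    where
    cross : (A ℤ.* canonC x ≡ canonA x ℤ.* C) × (B ℤ.* canonC x ≡ canonB x ℤ.* C)
    cross = represents-cross x≈ABC (canon-represents x)

  valGe-⊗ : ∀ m m′ x y → ValGe p r m x → ValGe p r m′ y → ValGe p r (m ℕ.+ m′) (_⊗_ D x y)
  valGe-⊗ m m′ x y h h′ = represents⇒valGe (m ℕ.+ m′) (_⊗_ D x y) _ _ _
    (represents-⊗ D (canon-represents x) (canon-represents y)) (canonC*canonC≢0 x y)
    (valGeℤ-* m m′ (canonA x) (canonB x) (canonC x) (canonA y) (canonB y) (canonC y)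
      (valGe⇒valGeℤ m x h) (valGe⇒valGeℤ m′ y h′))

  valGe-⊖ : ∀ m x y → ValGe p r m x → ValGe p r m y → ValGe p r m (_⊖_ D x y)
  valGe-⊖ m x y h h′ = represents⇒valGe m (_⊖_ D x y) _ _ _
    (represents-⊖ D (canon-represents x) (canon-represents y)) (canonC*canonC≢0 x y)
    (valGeℤ-− m (canonA x) (canonB x) (canonC x) (canonA y) (canonB y) (canonC y)
      (valGe⇒valGeℤ m x h) (valGe⇒valGeℤ m y h′))

  valGe-pred : ∀ m x → ValGe p r (suc m) x → ValGe p r m x
  valGe-pred m x =
    valGeℤ⇒valGe m x ∘ valGeℤ-pred m (canonA x) (canonB x) (canonC x) ∘ valGe⇒valGeℤ (suc m) x

  ¬valGe-one : ¬ ValGe p r 1 oneK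
  ¬valGe-one = ¬valGeℤ-one ∘ valGe⇒valGeℤ 1 oneK

  valGe-zero : ∀ m → ValGe p r m (embed 0ℚ)
  valGe-zero m = valGeℤ⇒valGe m (embed 0ℚ) (∣⇒valGeℤ m ℤ.0ℤ ℤ.0ℤ 0 ℤ.1ℤ p∤1 (divides ℤ.0ℤ refl))

  valGe-swap : ∀ m y z → ValGe p r m (y -ᴷ z) → ValGe p r m (z -ᴷ y)
  valGe-swap m y z h =
    subst (ValGe p r m) (sym (-ᴷ-swap y z)) (valGe-⊖ m zeroK (y -ᴷ z) (valGe-zero m) h)

  valGe? : ∀ m x → Dec (ValGe p r m x)
  valGe? m x with valGeℤ? m (canonA x) (canonB x) (canonC x) (canonC≢0 x)
  ... | yes h = yes (valGeℤ⇒valGe m x h)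
  ... | no ¬h = no (¬h ∘ valGe⇒valGeℤ m x)

  valGe-inverse : ∀ i j y f → i ℕ.+ j ≡ 1 → _⊗_ D y f ≡ oneK → ¬ ValGe p r j f → ValGe p r i y
  valGe-inverse i j y f i+j≡1 yf≡1 ¬vⱼ = valGeℤ⇒valGe i y
    (valGeℤ-inverse i j (canonA f) (canonB f) (canonC f) (canonA y) (canonB y) (canonC y)
      i+j≡1 (canonC≢0 f) (canonC≢0 y) real imaginary (¬vⱼ ∘ valGeℤ⇒valGe j f))
    where
    A B C : ℤ
    A = canonA y ℤ.* canonA f ℤ.+ D ℤ.* (canonB y ℤ.* canonB f)
    B = canonA y ℤ.* canonB f ℤ.+ canonB y ℤ.* canonA f
    C = canonC y ℤ.* canonC f
    cross : (A ℤ.* ℤ.1ℤ ≡ ℤ.1ℤ ℤ.* C) × (B ℤ.* ℤ.1ℤ ≡ ℤ.0ℤ ℤ.* C)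
    cross = represents-cross
      (subst (λ w → Represents w A B C) yf≡1
             (represents-⊗ D (canon-represents y) (canon-represents f)))
      (canon-represents oneK)
    real : A ≡ C
    real = trans (sym (ℤP.*-identityʳ A)) (trans (proj₁ cross) (ℤP.*-identityˡ C))
    imaginary : B ≡ ℤ.0ℤ
    imaginary = trans (sym (ℤP.*-identityʳ B)) (proj₂ cross)

module BrowkinExpansion {p : ℕ} (p-prime : Prime p) (D : ℤ) (r : ℕ → ℤ) (sqrt : IsSqrtSeq p D r)
                        (x : K) (a : ℕ → ℚ) (α : ℕ → K) (cf : IsBrowkinCF p D r x a α) where

  open Valuation p-prime D r sqrt
  open QuadraticField D

  ε : ℕ → K
  ε j = α j -ᴷ embed (a j)

  valGe-ε : ∀ j → ValGe p r 1 (ε j)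
  valGe-ε j = proj₁ (proj₂ (proj₂ cf j))

  α*ε≡1 : ∀ j → α (suc j) *ᴷ ε j ≡ oneK
  α*ε≡1 j = proj₂ (proj₂ (proj₂ cf j))

  conj-α*ε≡1 : ∀ j → conj (α (suc j)) *ᴷ conj (ε j) ≡ oneK
  conj-α*ε≡1 j = trans (sym (conj-* (α (suc j)) (ε j))) (cong conj (α*ε≡1 j))

  ¬valGe-α : ∀ j → ¬ ValGe p r 0 (α (suc j))
  ¬valGe-α j h =
    ¬valGe-one (subst (ValGe p r 1) (α*ε≡1 j) (valGe-⊗ 0 1 (α (suc j)) (ε j) h (valGe-ε j)))

  valGe-conj-α : ∀ j → ¬ ValGe p r 1 (conj (ε j)) → ValGe p r 0 (conj (α (suc j)))
  valGe-conj-α j = valGe-inverse 0 1 (conj (α (suc j))) (conj (ε j)) refl (conj-α*ε≡1 j)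

  valGe-conj-α-step : ∀ j → ValGe p r 0 (conj (α (suc j))) → ValGe p r 1 (conj (α (suc (suc j))))
  valGe-conj-α-step j h = valGe-inverse 1 0 (conj (α (suc (suc j)))) (conj ε′) refl
    (conj-α*ε≡1 (suc j)) ¬valGe-conj-ε
    where
    α′ ε′ : K
    α′ = α (suc j)
    ε′ = ε (suc j)
    α′-decomposed : α′ ≡ (ε′ -ᴷ conj ε′) -ᴷ (zeroK -ᴷ conj α′)
    α′-decomposed =
      trans (-ᴷ-cancel α′ (conj α′)) (cong (_-ᴷ (zeroK -ᴷ conj α′)) (-ᴷ-conj-shift α′ (a (suc j))))
    ¬valGe-conj-ε : ¬ ValGe p r 0 (conj ε′)
    ¬valGe-conj-ε h′ = ¬valGe-α j (subst (ValGe p r 0) (sym α′-decomposed)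
      (valGe-⊖ 0 (ε′ -ᴷ conj ε′) (zeroK -ᴷ conj α′)
        (valGe-⊖ 0 ε′ (conj ε′) (valGe-pred 0 ε′ (valGe-ε (suc j))) h′)
        (valGe-⊖ 0 zeroK (conj α′) (valGe-zero 0) h)))

  valGe-conj-α-persists : ∀ d j → ValGe p r 0 (conj (α (suc j))) →
                          ValGe p r 1 (conj (α (suc (suc (d ℕ.+ j)))))
  valGe-conj-α-persists ℕ.zero  j h = valGe-conj-α-step j h
  valGe-conj-α-persists (suc d) j h = valGe-conj-α-step (suc (d ℕ.+ j))
    (valGe-pred 0 (conj (α (suc (suc (d ℕ.+ j))))) (valGe-conj-α-persists d j h))

  α-conj-recurrence : ∀ j →
    α j -ᴷ conj (α j) ≡ ((conj (α (suc j)) -ᴷ α (suc j)) *ᴷ ε j) *ᴷ conj (ε j)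
  α-conj-recurrence j = begin
    α j -ᴷ conj (α j)
      ≡⟨ -ᴷ-conj-shift (α j) (a j) ⟩
    ε j -ᴷ conj (ε j)
      ≡⟨ cong₂ _-ᴷ_ (*-identityˡ (ε j)) (*-identityˡ (conj (ε j))) ⟨
    oneK *ᴷ ε j -ᴷ oneK *ᴷ conj (ε j)
      ≡⟨ cong₂ (λ u v → u *ᴷ ε j -ᴷ v *ᴷ conj (ε j)) (conj-α*ε≡1 j) (α*ε≡1 j) ⟨
    (conj (α (suc j)) *ᴷ conj (ε j)) *ᴷ ε j -ᴷ (α (suc j) *ᴷ ε j) *ᴷ conj (ε j)
      ≡⟨ -ᴷ-*-distrib (conj (α (suc j))) (α (suc j)) (ε j) (conj (ε j)) ⟨
    ((conj (α (suc j)) -ᴷ α (suc j)) *ᴷ ε j) *ᴷ conj (ε j)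
      ∎
    where open ≡-Reasoning

  regular-or-close : ∀ {n} d j → j ℕ.+ d ≡ n →
    ValGe p r 1 (conj (α (suc (suc n)))) ⊎ ValGe p r (suc (2 * d)) (α j -ᴷ conj (α j))
  regular-or-close d j j+d≡n with valGe? 1 (conj (ε j))
  ... | no ¬v = inj₁ (subst (λ k → ValGe p r 1 (conj (α (suc (suc k)))))
                            (trans (ℕP.+-comm d j) j+d≡n)
                            (valGe-conj-α-persists d j (valGe-conj-α j ¬v)))
  regular-or-close ℕ.zero j _ | yes v = inj₂ (subst (ValGe p r 1) (sym (-ᴷ-conj-shift (α j) (a j)))
    (valGe-⊖ 1 (ε j) (conj (ε j)) (valGe-ε j) v))
  regular-or-close (suc d) j j+d≡n | yes v
    with regular-or-close d (suc j) (trans (sym (ℕP.+-suc j d)) j+d≡n)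
  ... | inj₁ regular = inj₁ regular
  ... | inj₂ close = inj₂ (subst₂ (ValGe p r) (exponent d) (sym (α-conj-recurrence j))
    (valGe-⊗ (m ℕ.+ 1) 1 (δ *ᴷ ε j) (conj (ε j)) (valGe-⊗ m 1 δ (ε j) δ-close (valGe-ε j)) v))
    where
    m : ℕ
    m = suc (2 * d)
    δ : K
    δ = conj (α (suc j)) -ᴷ α (suc j)
    δ-close : ValGe p r m δ
    δ-close = valGe-swap m (α (suc j)) (conj (α (suc j))) close
    exponent : ∀ d → suc (2 * d) ℕ.+ 1 ℕ.+ 1 ≡ suc (2 * suc d)
    exponent = ℕSolver.solve-∀

proposition3p2 : (p : ℕ) → Prime p → 2 < p →
    (D : ℤ) → (∀ (q : ℚ) → q Data.Rational.* q ≢ D / 1) →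
    (r : ℕ → ℤ) → IsSqrtSeq p D r →
    (x₀ y₀ : ℚ) → y₀ ≢ 0ℚ →
    (n : ℕ) →
    ¬ ValGe p r (suc (2 * n)) (_⊖_ D (x₀ , y₀) (conj (x₀ , y₀))) →
    (a : ℕ → ℚ) (α : ℕ → K) → IsBrowkinCF p D r (x₀ , y₀) a α →
    Regular p r (α (suc (suc n)))
proposition3p2 p p-prime _ D _ r sqrt x₀ y₀ _ n far a α cf@(α₀≡x , _) =
  ¬valGe-α (suc n) , [ id , ⊥-elim ∘ far ∘ at-x ]′ (regular-or-close n 0 refl)
  where
  open BrowkinExpansion p-prime D r sqrt (x₀ , y₀) a α cf
  at-x : ValGe p r (suc (2 * n)) (_⊖_ D (α 0) (conj (α 0))) →
         ValGe p r (suc (2 * n)) (_⊖_ D (x₀ , y₀) (conj (x₀ , y₀)))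
  at-x = subst (λ w → ValGe p r (suc (2 * n)) (_⊖_ D w (conj w))) α₀≡x
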